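{- Let $(\mathbb{A},D)$ be a designated $\mathsf{Cobounded}$-algebra in which $D$ contains at least two elements. Then both logics $\mathbf{L}(\llbracket\cdot\rrbracket_{\mathrm{BA}},\mathbf{V}^{(\mathbb{A})})$ and $\mathbf{L}(\llbracket\cdot\rrbracket_{\mathrm{PA}},\mathbf{V}^{(\mathbb{A})})$ are paraconsistent; that is, there exist sentences $\varphi,\psi$ of $\mathcal{L}_\in$ such that $\llbracket(\varphi\wedge\neg\varphi)\to\psi\rrbracket_{\mathrm{BA}}\notin D$ and $\llbracket(\varphi\wedge\neg\varphi)\to\psi\rrbracket_{\mathrm{PA}}\notin D$.
   Context: A designated set is a lattice filter $D$ with $\mathbf{1}\in D$, $\mathbf{0}\notin D$. A $\mathsf{Cobounded}$-algebra is $\langle\mathbf{A},\wedge,\vee,\Rightarrow,\mathbf{1},\mathbf{0}\rangle$ with complete distributive lattice reduct, such that $\bigvee_i a_i=\mathbf{1}$ implies some $a_j=\mathbf{1}$, $\bigwedge_i a_i=\mathbf{0}$ implies some $a_j=\mathbf{0}$, and $a\Rightarrow b=\mathbf{0}$ if $a\ne\mathbf{0},b=\mathbf{0}$, else $\mathbf{1}$. A designated $\mathsf{Cobounded}$-algebra $(\mathbb{A},D)$ adds ${}^*$: $a^*=\mathbf{0}$ if $a=\mathbf{1}$, $a^*=a$ if $a\in D\setminus\{\mathbf{1}\}$, $a^*=\mathbf{1}$ if $a\notin D$. $\mathbf{V}^{(\mathbb{A})}$ = class of $\mathbf{A}$-valued functions defined by recursion ($\mathbf{V}^{(\mathbb{A})}_\alpha$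 = functions with range in $\mathbf{A}$ and domain $\subseteq\mathbf{V}^{(\mathbb{A})}_\xi$ for some $\xi<\alpha$). Assignment functions: $\llbracket u\in v\rrbracket_{X}=\bigvee_{x\in\mathrm{dom}(v)}(v(x)\wedge\llbracket x=u\rrbracket_X)$ for $X\in\{\mathrm{BA},\mathrm{PA}\}$; $\llbracket u=v\rrbracket_{\mathrm{BA}}=\bigwedge_{x\in\mathrm{dom}(u)}(u(x)\Rightarrow\llbracket x\in v\rrbracket_{\mathrm{BA}})\wedge\bigwedge_{y\in\mathrm{dom}(v)}(v(y)\Rightarrow\llbracket y\in u\rrbracket_{\mathrm{BA}})$; $\llbracket u=v\rrbracket_{\mathrm{PA}}=\bigwedge_{x\in\mathrm{dom}(u)}((u(x)\Rightarrow\llbracket x\in v\rrbracket_{\mathrm{PA}})\wedge(\llbracket x\in v\rrbracket_{\mathrm{PA}}^*\Rightarrow u(x)^*))\wedge\bigwedge_{y\in\mathrm{dom}(v)}((v(y)\Rightarrow\llbracket y\in u\rrbracket_{\mathrm{PA}})\wedge(\llbracket y\in u\rrbracket_{\mathrm{PA}}^*\Rightarrow v(y)^*))$; both extended homomorphically ($\top,\bot\mapsto\mathbf{1},\mathbf{0}$; $\wedge,\vee,\to,\neg\mapsto\wedge,\vee,\Rightarrow,{}^*$; $\forall,\exists\mapsto\bigwedge,\bigvee$ over $\mathbf{V}^{(\mathbb{A})}$). A translation is a homomorphism $\tau$ from propositional formulas (connectives $\wedge,\vee,\to,\neg,\top,\bot$) to sentences of $\mathcal{L}_\in$. $\mathbf{L}(\llbracket\cdot\rrbracket,\mathbf{V}^{(\mathbb{A})})$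 is the set of propositional formulas $\alpha$ with $\llbracket\tau(\alpha)\rrbracket\in D$ for every translation $\tau$. Such a logic is called paraconsistent if there are sentences $\varphi,\psi$ of $\mathcal{L}_\in$ with $(\varphi\wedge\neg\varphi)\to\psi$ not valid, i.e. its value is not in $D$. -}

module Defs where

open import Level using (Level; _⊔_; Setω) renaming (suc to lsuc)
open import Data.Nat using (ℕ; suc)
open import Data.Fin using (Fin; zero; suc)
open import Data.Product using (Σ; _×_; _,_; ∃-syntax)
open import Relation.Nullary using (¬_)
open import Relation.Binary.PropositionalEquality using (_≡_; _≢_)
open import Algebra.Lattice.Structures using (IsDistributiveLattice)

record CoboundedAlgebra (a : Level) : Setω where
  infixr 6 _∧_
  infixr 5 _∨_
  infixr 4 _⇒_
  field
    Carrier : Set a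
    _∧_ _∨_ _⇒_ : Carrier → Carrier → Carrier
    𝟏 𝟎 : Carrier
    ⋁ ⋀ : ∀ {ι} {I : Set ι} → (I → Carrier) → Carrier

  _≤_ : Carrier → Carrier → Set a
  x ≤ y = x ∧ y ≡ x

  field
    isDistributiveLattice : IsDistributiveLattice _≡_ _∨_ _∧_
    𝟎-least   : ∀ x → 𝟎 ≤ x
    𝟏-greatest : ∀ x → x ≤ 𝟏
    ⋁-upper : ∀ {ι} {I : Set ι} (f : I → Carrier) (i : I) → f i ≤ ⋁ f
    ⋁-least : ∀ {ι} {I : Set ι} (f : I → Carrier) (z : Carrier) →
              (∀ i → f i ≤ z) → ⋁ f ≤ z
    ⋀-lower : ∀ {ι} {I : Set ι} (f : I → Carrier) (i : I) → ⋀ f ≤ f i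
    ⋀-greatest : ∀ {ι} {I : Set ι} (f : I → Carrier) (z : Carrier) →
                 (∀ i → z ≤ f i) → z ≤ ⋀ f
    ⋁-𝟏 : ∀ {ι} {I : Set ι} (f : I → Carrier) → ⋁ f ≡ 𝟏 → ∃[ j ] f j ≡ 𝟏
    ⋀-𝟎 : ∀ {ι} {I : Set ι} (f : I → Carrier) → ⋀ f ≡ 𝟎 → ∃[ j ] f j ≡ 𝟎
    ⇒-𝟎 : ∀ x y → x ≢ 𝟎 → y ≡ 𝟎 → (x ⇒ y) ≡ 𝟎
    ⇒-𝟏 : ∀ x y → ¬ (x ≢ 𝟎 × y ≡ 𝟎) → (x ⇒ y) ≡ 𝟏

record DesignatedCobounded (a d : Level) : Setω where
  field
    algebra : CoboundedAlgebra a
  open CoboundedAlgebra algebra public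
  infix 8 _*
  field
    D : Carrier → Set d
    D-upward : ∀ x y → D x → x ≤ y → D y
    D-∧ : ∀ x y → D x → D y → D (x ∧ y)
    D-𝟏 : D 𝟏
    D-𝟎 : ¬ D 𝟎
    _* : Carrier → Carrier
    *-𝟏 : ∀ x → x ≡ 𝟏 → x * ≡ 𝟎
    *-D : ∀ x → D x → x ≢ 𝟏 → x * ≡ x
    *-¬D : ∀ x → ¬ D x → x * ≡ 𝟏

DHasTwoElements : ∀ {a d} → DesignatedCobounded a d → Set (a ⊔ d)
DHasTwoElements 𝔸 = ∃[ x ] ∃[ y ] (D x × D y × x ≢ y)
  where open DesignatedCobounded 𝔸

-- Formulas of the language of set theory (de Bruijn variables)

data Formula (n : ℕ) : Set where
  _∈'_ _≐_ : Fin n → Fin n → Formula n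
  ⊤' ⊥' : Formula n
  _∧'_ _∨'_ _→'_ : Formula n → Formula n → Formula n
  ¬'_ : Formula n → Formula n
  ∀' ∃' : Formula (suc n) → Formula n

Sentence : Set
Sentence = Formula 0

module Semantics {a d : Level} (𝔸 : DesignatedCobounded a d) where
  open DesignatedCobounded 𝔸

  -- A name: a function with domain a (set-indexed) family of names
  -- and values in the carrier.  Index sets live in Set i.
  data V (i : Level) : Set (lsuc i ⊔ a) where
    mk : (I : Set i) → (I → V i) → (I → Carrier) → V i

  module _ {i : Level} where

    extend : ∀ {n} → (Fin n → V i) → V i → Fin (suc n) → V i
    extend ρ x zero = x
    extend ρ x (suc k) = ρ k

    eval : (V i → V i → Carrier) → (V i → V i → Carrier) →
           ∀ {n} → (Fin n → V i) → Formula n → Carrier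
    eval mem eq ρ (x ∈' y) = mem (ρ x) (ρ y)
    eval mem eq ρ (x ≐ y) = eq (ρ x) (ρ y)
    eval mem eq ρ ⊤' = 𝟏
    eval mem eq ρ ⊥' = 𝟎
    eval mem eq ρ (φ ∧' ψ) = eval mem eq ρ φ ∧ eval mem eq ρ ψ
    eval mem eq ρ (φ ∨' ψ) = eval mem eq ρ φ ∨ eval mem eq ρ ψ
    eval mem eq ρ (φ →' ψ) = eval mem eq ρ φ ⇒ eval mem eq ρ ψ
    eval mem eq ρ (¬' φ) = (eval mem eq ρ φ) *
    eval mem eq ρ (∀' φ) = ⋀ (λ (x : V i) → eval mem eq (extend ρ x) φ)
    eval mem eq ρ (∃' φ) = ⋁ (λ (x : V i) → eval mem eq (extend ρ x) φ)

    empty : Fin 0 → V i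
    empty ()

    mutual
      memBA : V i → V i → Carrier
      memBA u (mk J g b) = ⋁ (λ y → b y ∧ eqBA (g y) u)

      eqBA : V i → V i → Carrier
      eqBA (mk I f a′) (mk J g b) =
        ⋀ (λ x → a′ x ⇒ memBA (f x) (mk J g b)) ∧
        ⋀ (λ y → b y ⇒ memBA (g y) (mk I f a′))

    ⟦_⟧BA : Sentence → Carrier
    ⟦ φ ⟧BA = eval memBA eqBA empty φ

    mutual
      memPA : V i → V i → Carrier
      memPA u (mk J g b) = ⋁ (λ y → b y ∧ eqPA (g y) u)

      eqPA : V i → V i → Carrier
      eqPA (mk I f a′) (mk J g b) =
        ⋀ (λ x → (a′ x ⇒ memPA (f x) (mk J g b)) ∧
                 (memPA (f x) (mk J g b) * ⇒ a′ x *)) ∧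
        ⋀ (λ y → (b y ⇒ memPA (g y) (mk I f a′)) ∧
                 (memPA (g y) (mk I f a′) * ⇒ b y *))

    ⟦_⟧PA : Sentence → Carrier
    ⟦ φ ⟧PA = eval memPA eqPA empty φ

{-# OPTIONS --safe #-}
module Submission where

-- Take φ = ∃x ∃y (y ∈ x ∧ ¬ y ∈ x) and ψ = ⊥. Since D has two elements,
-- some c ∈ D differs from 𝟏; the name {∅ ↦ c} has ⟦∅ ∈ {∅ ↦ c}⟧ = c under
-- both assignments, and c ∧ c* = c, so t = ⟦φ⟧ ≠ 𝟎. By coboundedness t = 𝟏
-- would force some m ∧ m* = 𝟏, i.e. m = m* = 𝟏, which is impossible. For t
-- outside {𝟎, 𝟏} the value t* is t or 𝟏, so t ∧ t* = t ≠ 𝟎 and therefore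
-- ⟦(φ ∧ ¬φ) → ψ⟧ = (t ∧ t*) ⇒ 𝟎 = 𝟎 ∉ D.

open import Defs
open import Level using (Level)
open import Data.Product using (Σ-syntax; _×_; _,_; ∃-syntax)
open import Data.Empty using (⊥-elim)
open import Data.Empty.Polymorphic using (⊥)
open import Data.Unit.Polymorphic using (⊤; tt)
open import Data.Fin using (zero; suc)
open import Relation.Nullary using (¬_)
open import Relation.Binary.PropositionalEquality
  using (_≡_; _≢_; refl; sym; trans; cong; cong₂; subst; module ≡-Reasoning)
open import Algebra.Lattice.Bundles using (DistributiveLattice)
import Algebra.Lattice.Properties.DistributiveLattice as DistributiveLatticeProperties

module CoboundedAlgebraProperties {a} (𝔸 : CoboundedAlgebra a) where
  open CoboundedAlgebra 𝔸
  open ≡-Reasoning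

  distributiveLattice : DistributiveLattice a a
  distributiveLattice = record { isDistributiveLattice = isDistributiveLattice }

  open DistributiveLattice distributiveLattice public using (∧-comm; ∧-assoc)
  open DistributiveLatticeProperties distributiveLattice public using (∧-idem)

  ≤-antisym : ∀ {x y} → x ≤ y → y ≤ x → x ≡ y
  ≤-antisym {x} {y} x≤y y≤x = begin
    x      ≡⟨ x≤y ⟨
    x ∧ y  ≡⟨ ∧-comm x y ⟩
    y ∧ x  ≡⟨ y≤x ⟩
    y      ∎

  x≤𝟎⇒x≡𝟎 : ∀ {x} → x ≤ 𝟎 → x ≡ 𝟎
  x≤𝟎⇒x≡𝟎 {x} x≤𝟎 = begin
    x      ≡⟨ x≤𝟎 ⟨
    x ∧ 𝟎  ≡⟨ ∧-comm x 𝟎 ⟩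
    𝟎 ∧ x  ≡⟨ 𝟎-least x ⟩
    𝟎      ∎

  x∧y≡𝟏⇒x≡𝟏 : ∀ {x y} → x ∧ y ≡ 𝟏 → x ≡ 𝟏
  x∧y≡𝟏⇒x≡𝟏 {x} {y} x∧y≡𝟏 = begin
    x            ≡⟨ 𝟏-greatest x ⟨
    x ∧ 𝟏        ≡⟨ cong (x ∧_) x∧y≡𝟏 ⟨
    x ∧ (x ∧ y)  ≡⟨ ∧-assoc x x y ⟨
    (x ∧ x) ∧ y  ≡⟨ cong (_∧ y) (∧-idem x) ⟩
    x ∧ y        ≡⟨ x∧y≡𝟏 ⟩
    𝟏            ∎

  x∧y≡𝟏⇒y≡𝟏 : ∀ {x y} → x ∧ y ≡ 𝟏 → y ≡ 𝟏
  x∧y≡𝟏⇒y≡𝟏 {x} {y} x∧y≡𝟏 = x∧y≡𝟏⇒x≡𝟏 (trans (∧-comm y x) x∧y≡𝟏)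

  ⋀-empty : ∀ {ι} {I : Set ι} → ¬ I → (f : I → Carrier) → ⋀ f ≡ 𝟏
  ⋀-empty ¬I f = ≤-antisym (𝟏-greatest (⋀ f)) (⋀-greatest f 𝟏 (λ i → ⊥-elim (¬I i)))

  ⋁-const : ∀ {ι} {I : Set ι} → I → (x : Carrier) → ⋁ (λ (_ : I) → x) ≡ x
  ⋁-const i x = ≤-antisym (⋁-least _ x (λ _ → ∧-idem x)) (⋁-upper _ i)

  ⋁-≢𝟎 : ∀ {ι} {I : Set ι} (f : I → Carrier) (i : I) → f i ≢ 𝟎 → ⋁ f ≢ 𝟎
  ⋁-≢𝟎 f i fi≢𝟎 ⋁f≡𝟎 = fi≢𝟎 (x≤𝟎⇒x≡𝟎 (subst (f i ≤_) ⋁f≡𝟎 (⋁-upper f i)))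

  ⋁-≢𝟏 : ∀ {ι} {I : Set ι} (f : I → Carrier) → (∀ i → f i ≢ 𝟏) → ⋁ f ≢ 𝟏
  ⋁-≢𝟏 f f≢𝟏 ⋁f≡𝟏 = let (i , fi≡𝟏) = ⋁-𝟏 f ⋁f≡𝟏 in f≢𝟏 i fi≡𝟏

module DesignatedCoboundedProperties {a d} (𝔸 : DesignatedCobounded a d) where
  open DesignatedCobounded 𝔸
  open CoboundedAlgebraProperties algebra public
  open ≡-Reasoning

  𝟏≢𝟎 : 𝟏 ≢ 𝟎
  𝟏≢𝟎 𝟏≡𝟎 = D-𝟎 (subst D 𝟏≡𝟎 D-𝟏)

  D⇒≢𝟎 : ∀ {x} → D x → x ≢ 𝟎
  D⇒≢𝟎 Dx x≡𝟎 = D-𝟎 (subst D x≡𝟎 Dx)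

  ¬¬∃D≢𝟏 : DHasTwoElements 𝔸 → ¬ ¬ (∃[ c ] D c × c ≢ 𝟏)
  ¬¬∃D≢𝟏 (x , y , Dx , Dy , x≢y) ¬∃ =
    ¬∃ (x , Dx , λ x≡𝟏 → ¬∃ (y , Dy , λ y≡𝟏 → x≢y (trans x≡𝟏 (sym y≡𝟏))))

  x∧x*≢𝟏 : ∀ x → x ∧ x * ≢ 𝟏
  x∧x*≢𝟏 x x∧x*≡𝟏 = 𝟏≢𝟎 (begin
    𝟏    ≡⟨ x∧y≡𝟏⇒y≡𝟏 x∧x*≡𝟏 ⟨
    x *  ≡⟨ *-𝟏 x (x∧y≡𝟏⇒x≡𝟏 x∧x*≡𝟏) ⟩
    𝟎    ∎)

  -- x ∧ x* = x both when x ∈ D (x* = x) and when x ∉ D (x* = 𝟏); as D need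
  -- not be decidable, the case split is made under the negation.
  x∧x*≢𝟎 : ∀ {x} → x ≢ 𝟎 → x ≢ 𝟏 → x ∧ x * ≢ 𝟎
  x∧x*≢𝟎 {x} x≢𝟎 x≢𝟏 x∧x*≡𝟎 = x≢𝟎 (begin
    x       ≡⟨ 𝟏-greatest x ⟨
    x ∧ 𝟏   ≡⟨ cong (x ∧_) (*-¬D x x∉D) ⟨
    x ∧ x * ≡⟨ x∧x*≡𝟎 ⟩
    𝟎       ∎)
    where
    x∉D : ¬ D x
    x∉D Dx = x≢𝟎 (begin
      x       ≡⟨ ∧-idem x ⟨
      x ∧ x   ≡⟨ cong (x ∧_) (*-D x Dx x≢𝟏) ⟨
      x ∧ x * ≡⟨ x∧x*≡𝟎 ⟩
      𝟎       ∎)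

  ¬D[x∧x*⇒𝟎] : ∀ {x} → x ≢ 𝟎 → x ≢ 𝟏 → ¬ D ((x ∧ x *) ⇒ 𝟎)
  ¬D[x∧x*⇒𝟎] x≢𝟎 x≢𝟏 D[x∧x*⇒𝟎] =
    D-𝟎 (subst D (⇒-𝟎 _ 𝟎 (x∧x*≢𝟎 x≢𝟎 x≢𝟏) refl) D[x∧x*⇒𝟎])

module Paraconsistency {a d} (𝔸 : DesignatedCobounded a d) {i : Level} where
  open DesignatedCobounded 𝔸
  open DesignatedCoboundedProperties 𝔸
  open Semantics 𝔸
  open ≡-Reasoning

  ∅ : V i
  ∅ = mk ⊥ (λ ()) (λ ())

  singleton : Carrier → V i
  singleton c = mk ⊤ (λ _ → ∅) (λ _ → c)

  eqBA-∅ : eqBA ∅ ∅ ≡ 𝟏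
  eqBA-∅ = trans (cong₂ _∧_ (⋀-empty (λ ()) _) (⋀-empty (λ ()) _)) (∧-idem 𝟏)

  eqPA-∅ : eqPA ∅ ∅ ≡ 𝟏
  eqPA-∅ = trans (cong₂ _∧_ (⋀-empty (λ ()) _) (⋀-empty (λ ()) _)) (∧-idem 𝟏)

  memBA-∅-singleton : ∀ c → memBA ∅ (singleton c) ≡ c
  memBA-∅-singleton c = begin
    ⋁ (λ _ → c ∧ eqBA ∅ ∅)  ≡⟨ ⋁-const tt _ ⟩
    c ∧ eqBA ∅ ∅            ≡⟨ cong (c ∧_) eqBA-∅ ⟩
    c ∧ 𝟏                   ≡⟨ 𝟏-greatest c ⟩
    c                       ∎

  memPA-∅-singleton : ∀ c → memPA ∅ (singleton c) ≡ c
  memPA-∅-singleton c = begin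
    ⋁ (λ _ → c ∧ eqPA ∅ ∅)  ≡⟨ ⋁-const tt _ ⟩
    c ∧ eqPA ∅ ∅            ≡⟨ cong (c ∧_) eqPA-∅ ⟩
    c ∧ 𝟏                   ≡⟨ 𝟏-greatest c ⟩
    c                       ∎

  contradictoryMember : Sentence
  contradictoryMember = ∃' (∃' ((y ∈' x) ∧' (¬' (y ∈' x))))
    where
    x = suc zero
    y = zero

  module _ (mem eq : V i → V i → Carrier) where

    ⟦contradictoryMember⟧ : Carrier
    ⟦contradictoryMember⟧ = eval mem eq empty contradictoryMember

    ⟦contradictoryMember⟧≢𝟏 : ⟦contradictoryMember⟧ ≢ 𝟏
    ⟦contradictoryMember⟧≢𝟏 = ⋁-≢𝟏 _ (λ X → ⋁-≢𝟏 _ (λ Y → x∧x*≢𝟏 (mem Y X)))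

    ⟦contradictoryMember⟧≢𝟎 : ∀ {c} → mem ∅ (singleton c) ≡ c → D c → c ≢ 𝟏 →
                              ⟦contradictoryMember⟧ ≢ 𝟎
    ⟦contradictoryMember⟧≢𝟎 {c} m≡c Dc c≢𝟏 =
      ⋁-≢𝟎 _ (singleton c) (⋁-≢𝟎 _ ∅ (x∧x*≢𝟎 m≢𝟎 m≢𝟏))
      where
      m≢𝟎 : mem ∅ (singleton c) ≢ 𝟎
      m≢𝟎 = subst (_≢ 𝟎) (sym m≡c) (D⇒≢𝟎 Dc)
      m≢𝟏 : mem ∅ (singleton c) ≢ 𝟏
      m≢𝟏 = subst (_≢ 𝟏) (sym m≡c) c≢𝟏

    exFalso-undesignated : (∀ c → mem ∅ (singleton c) ≡ c) → DHasTwoElements 𝔸 →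
      ¬ D (eval mem eq empty ((contradictoryMember ∧' (¬' contradictoryMember)) →' ⊥'))
    exFalso-undesignated mem-∅-singleton two D[exFalso] =
      ¬¬∃D≢𝟏 two λ (c , Dc , c≢𝟏) →
        ¬D[x∧x*⇒𝟎] (⟦contradictoryMember⟧≢𝟎 (mem-∅-singleton c) Dc c≢𝟏)
                   ⟦contradictoryMember⟧≢𝟏 D[exFalso]

mainTheorem4 : ∀ {a d} (𝔸 : DesignatedCobounded a d) → DHasTwoElements 𝔸 →
    (i : Level) →
    Σ[ φ ∈ Sentence ] Σ[ ψ ∈ Sentence ]
      (¬ DesignatedCobounded.D 𝔸
           (Semantics.⟦_⟧BA 𝔸 {i} ((φ ∧' (¬' φ)) →' ψ))
       × ¬ DesignatedCobounded.D 𝔸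
           (Semantics.⟦_⟧PA 𝔸 {i} ((φ ∧' (¬' φ)) →' ψ)))
mainTheorem4 𝔸 two i =
  contradictoryMember , ⊥' ,
  exFalso-undesignated memBA eqBA memBA-∅-singleton two ,
  exFalso-undesignated memPA eqPA memPA-∅-singleton two
  where
  open Semantics 𝔸
  open Paraconsistency 𝔸 {i}
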